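{- For all integers $k\ge0$ and $n\ge1$, \[ f_{121,212}(n,k)=\sum_{j=0}^{k} j!\binom{k}{j}\binom{n-1}{j-1}, \] and $f_{121,212}(0,k)=1$ for all $k\ge0$.
   Context: For integers $k,n\ge 0$, a word is an element of $[k]^n$, where $[k]=\{1,\dots,k\}$ is totally ordered. A pattern is a word $\tau\in[\ell]^m$ containing every letter $1,\dots,\ell$. A word $\sigma\in[k]^n$ contains $\tau$ if there are indices $1\le i_1<\dots<i_m\le n$ such that for all $1\le a,b\le m$ and each relation $\phi\in\{<,=,>\}$, $\sigma(i_a)\,\phi\,\sigma(i_b)$ holds iff $\tau(a)\,\phi\,\tau(b)$ holds; otherwise $\sigma$ avoids $\tau$. $f_{121,212}(n,k)$ is the number of words in $[k]^n$ that avoid both $121$ and $212$. Here $\binom{n-1}{ -1}=0$. -}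

module Defs where

open import Data.Nat using (ℕ; zero; suc; _+_; _*_; _∸_; _<_; _!)
open import Data.Nat.Combinatorics using (_C_)
open import Data.Fin using (Fin; toℕ)
open import Data.Vec using (Vec; lookup)
open import Data.List using (List; map; upTo)
open import Data.Nat.ListAction using (sum)
open import Data.Product using (∃; _×_)
open import Relation.Nullary using (¬_)
open import Relation.Binary.PropositionalEquality using (_≡_)
open import Data.Product using (Σ)

-- a word in [k]^n : letters Fin k (letter i represents i+1)
Word : ℕ → ℕ → Set
Word k n = Vec (Fin k) n

-- a pattern τ ∈ [ℓ]^m (surjectivity onto [ℓ] is irrelevant for the
-- containment relation itself; the patterns used below are surjective)

SameRel : ℕ → ℕ → ℕ → ℕ → Set
SameRel x y u v = ((x < y) → (u < v)) × ((u < v) → (x < y))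
                × ((x ≡ y) → (u ≡ v)) × ((u ≡ v) → (x ≡ y))
                × ((y < x) → (v < u)) × ((v < u) → (y < x))

Contains : ∀ {k n ℓ m} → Word k n → Word ℓ m → Set
Contains {k} {n} {ℓ} {m} σ τ =
  Σ (Fin m → Fin n) λ ι →
    ((a b : Fin m) → toℕ a < toℕ b → toℕ (ι a) < toℕ (ι b)) ×
    ((a b : Fin m) → SameRel (toℕ (lookup σ (ι a))) (toℕ (lookup σ (ι b)))
                              (toℕ (lookup τ a)) (toℕ (lookup τ b)))

Avoids : ∀ {k n ℓ m} → Word k n → Word ℓ m → Set
Avoids σ τ = ¬ Contains σ τ

open import Data.Fin using (zero; suc)
open import Data.Vec using ([]; _∷_)

p121 : Word 2 3
p121 = zero ∷ suc zero ∷ zero ∷ []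

p212 : Word 2 3
p212 = suc zero ∷ zero ∷ suc zero ∷ []

binomShift : ℕ → ℕ → ℕ   -- binomShift n j = C(n-1, j-1), n ≥ 1
binomShift n zero = 0
binomShift n (suc j) = (n ∸ 1) C j

rhs : ℕ → ℕ → ℕ
rhs n k = sum (map (λ j → (j !) * (k C j) * binomShift n j) (upTo (suc k)))

open import Data.List using (length)
open import Data.List.Membership.Propositional using (_∈_)
open import Data.List.Relation.Unary.Unique.Propositional using (Unique)
open import Function.Bundles using (_⇔_)

F121-212≡ : ℕ → ℕ → ℕ → Set
F121-212≡ n k c =
  Σ (List (Word k n)) λ ws →
    Unique ws ×
    ((σ : Word k n) → (σ ∈ ws) ⇔ (Avoids σ p121 × Avoids σ p212)) ×
    (length ws ≡ c)

-- A word avoids 121 and 212 exactly when it contains no a…b…a with a ≠ b, i.e. when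
-- every letter occupies one block of consecutive positions.  Such a word of length
-- n + 1 is its first letter x followed by a continuation which, position by
-- position, either repeats the current letter or switches to a letter not used so
-- far.  With u unused letters there are ∑ⱼ u↓j · C(n, j) continuations (choose the
-- j switch positions, then the j new letters injectively), so there are
-- k · ∑ⱼ (k−1)↓j · C(n, j) words; since j! · C(k, j) = k↓j this is the stated sum.
module Submission where

open import Defs
open import Data.Nat using (ℕ; zero; suc; _+_; _*_; _!; pred; _≥_; s≤s)
import Data.Nat as ℕ
import Data.Nat.Properties as ℕ
open import Data.Nat.Properties using (+-*-semiring; *-zeroʳ; *-assoc; *-distribˡ-+; +-comm)
open import Data.Nat.Combinatorics using (_C_; nCk+nC[k+1]≡[n+1]C[k+1])
open import Data.Nat.Tactic.RingSolver using (solve-∀)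
import Data.Nat.ListAction as List
open import Algebra.Properties.Semiring.Sum +-*-semiring
  using (sum-syntax; sum⁺-syntax; sum-cong-≗; sum-replicate-zero; ∑-distrib-+; *-distribˡ-sum)
open import Data.Fin using (Fin; zero; suc; toℕ; _<_; _≟_)
open import Data.Fin.Properties using (toℕ-injective; <-trans; <-cmp)
open import Data.Vec using (Vec; []; _∷_; lookup)
open import Data.Vec.Properties using (∷-injectiveʳ)
open import Data.Vec.Relation.Unary.All as Allᵥ using (All; []; _∷_)
open import Data.Vec.Relation.Unary.All.Properties using (lookup⁺; lookup⁻)
open import Data.List using (List; []; _∷_; [_]; map; _++_; length; filter; allFin; applyUpTo)
open import Data.List.Properties
  using (map-upTo; length-++; length-map; length-tabulate; filter-accept; filter-reject; filter-all)
open import Data.List.Membership.Propositional using (_∈_; _∉_)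
open import Data.List.Membership.Propositional.Properties
  using (∈-map⁺; ∈-map⁻; ∈-++⁺ˡ; ∈-++⁺ʳ; ∈-++⁻; ∈-filter⁺; ∈-filter⁻; ∈-allFin)
open import Data.List.Relation.Unary.Any using (here; there)
import Data.List.Relation.Unary.All as ListAll
open import Data.List.Relation.Unary.Unique.Propositional using (Unique; []; _∷_)
open import Data.List.Relation.Unary.Unique.Propositional.Properties
  using (map⁺; ++⁺; filter⁺; allFin⁺; Unique[x∷xs]⇒x∉xs)
open import Data.Product using (_×_; _,_; proj₁; proj₂)
open import Data.Sum using (_⊎_; inj₁; inj₂; [_,_]′)
open import Data.Empty using (⊥-elim)
open import Relation.Nullary using (¬_; Dec; yes; no; ¬?)
open import Relation.Binary using (DecidableEquality; tri<; tri≈; tri>)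
open import Relation.Binary.PropositionalEquality hiding ([_])
open import Function using (_∘_)
open import Function.Bundles using (_⇔_; mk⇔)
open import Function.Construct.Composition using (_⇔-∘_)

private
  variable
    k ℓ m n : ℕ

open ≡-Reasoning

infixl 7 _↓_

_↓_ : ℕ → ℕ → ℕ
k ↓ zero = 1
zero ↓ suc j = 0
suc k ↓ suc j = suc k * (k ↓ j)

-- k ↓ suc j = (k ∸ j) * (k ↓ j), stated without truncated subtraction.
↓-suc : ∀ k j → k ↓ suc j + suc j * (k ↓ j) ≡ suc k * (k ↓ j)
↓-suc zero zero = refl
↓-suc zero (suc j) = *-zeroʳ (suc (suc j))
↓-suc (suc k) zero = +-comm (suc k * 1) 1
↓-suc (suc k) (suc j) = begin
  suc k * (k ↓ suc j) + suc (suc j) * (suc k * (k ↓ j))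
    ≡⟨ regroup (suc k) (k ↓ suc j) (suc j) (k ↓ j) ⟩
  suc k * (k ↓ suc j + suc j * (k ↓ j)) + suc k * (k ↓ j)
    ≡⟨ cong (λ z → suc k * z + suc k * (k ↓ j)) (↓-suc k j) ⟩
  suc k * (suc k * (k ↓ j)) + suc k * (k ↓ j)
    ≡⟨ +-comm (suc k * (suc k * (k ↓ j))) _ ⟩
  suc (suc k) * (suc k * (k ↓ j)) ∎
  where
  regroup : ∀ a x b y → a * x + (1 + b) * (a * y) ≡ a * (x + b * y) + a * y
  regroup = solve-∀

!*C≡↓ : ∀ k j → j ! * (k C j) ≡ k ↓ j
!*C≡↓ k zero = refl
!*C≡↓ zero (suc j) = *-zeroʳ (suc j !)
!*C≡↓ (suc k) (suc j) = begin
  suc j ! * (suc k C suc j)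
    ≡⟨ cong (suc j ! *_) (sym (nCk+nC[k+1]≡[n+1]C[k+1] k j)) ⟩
  suc j ! * (k C j + k C suc j)
    ≡⟨ *-distribˡ-+ (suc j !) (k C j) _ ⟩
  suc j * j ! * (k C j) + suc j ! * (k C suc j)
    ≡⟨ cong₂ _+_ (*-assoc (suc j) (j !) (k C j)) (!*C≡↓ k (suc j)) ⟩
  suc j * (j ! * (k C j)) + k ↓ suc j
    ≡⟨ cong (λ z → suc j * z + k ↓ suc j) (!*C≡↓ k j) ⟩
  suc j * (k ↓ j) + k ↓ suc j
    ≡⟨ +-comm (suc j * (k ↓ j)) _ ⟩
  k ↓ suc j + suc j * (k ↓ j)
    ≡⟨ ↓-suc k j ⟩
  suc k * (k ↓ j) ∎

continuationCount : ℕ → ℕ → ℕ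
continuationCount n u = ∑[ j ≤ u ] (u ↓ toℕ j * (n C toℕ j))

continuationCount-zero : ∀ u → continuationCount 0 u ≡ 1
continuationCount-zero u =
  cong suc (trans (sum-cong-≗ {u} {y = λ _ → 0} (λ j → *-zeroʳ (u ↓ suc (toℕ j)))) (sum-replicate-zero u))

continuationCount-suc : ∀ n u →
  continuationCount (suc n) u ≡ continuationCount n u + u * continuationCount n (pred u)
continuationCount-suc n zero = refl
continuationCount-suc n (suc m) = cong suc (begin
  ∑[ j < suc m ] (suc m ↓ suc (toℕ j) * (suc n C suc (toℕ j)))
    ≡⟨ sum-cong-≗ {suc m} (λ j → trans
         (cong (suc m ↓ suc (toℕ j) *_) (sym (nCk+nC[k+1]≡[n+1]C[k+1] n (toℕ j))))
         (regroup (suc m) (m ↓ toℕ j) (n C toℕ j) (n C suc (toℕ j)))) ⟩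
  ∑[ j < suc m ] (f j + suc m * g j)
    ≡⟨ ∑-distrib-+ f (λ j → suc m * g j) ⟩
  ∑[ j < suc m ] f j + ∑[ j < suc m ] (suc m * g j)
    ≡⟨ cong (∑[ j < suc m ] f j +_) (*-distribˡ-sum (suc m) g) ⟨
  ∑[ j < suc m ] f j + suc m * continuationCount n m ∎)
  where
  f g : Fin (suc m) → ℕ
  f j = suc m ↓ suc (toℕ j) * (n C suc (toℕ j))
  g j = m ↓ toℕ j * (n C toℕ j)
  regroup : ∀ s d x y → s * d * (x + y) ≡ s * d * y + s * (d * x)
  regroup = solve-∀

sum-applyUpTo : ∀ (f : ℕ → ℕ) m → List.sum (applyUpTo f m) ≡ ∑[ i < m ] f (toℕ i)
sum-applyUpTo f zero = refl
sum-applyUpTo f (suc m) = cong (f 0 +_) (sum-applyUpTo (λ i → f (suc i)) m)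

rhs-suc : ∀ n k → rhs (suc n) k ≡ k * continuationCount n (pred k)
rhs-suc n zero = refl
rhs-suc n (suc m) = begin
  rhs (suc n) (suc m)
    ≡⟨ cong List.sum (map-upTo term (suc (suc m))) ⟩
  List.sum (applyUpTo term (suc (suc m)))
    ≡⟨ sum-applyUpTo term (suc (suc m)) ⟩
  ∑[ j < suc m ] (suc (toℕ j) ! * (suc m C suc (toℕ j)) * (n C toℕ j))
    ≡⟨ sum-cong-≗ {suc m} (λ j → trans (cong (_* (n C toℕ j)) (!*C≡↓ (suc m) (suc (toℕ j))))
                                        (*-assoc (suc m) (m ↓ toℕ j) (n C toℕ j))) ⟩
  ∑[ j < suc m ] (suc m * (m ↓ toℕ j * (n C toℕ j)))
    ≡⟨ *-distribˡ-sum {suc m} (suc m) (λ j → m ↓ toℕ j * (n C toℕ j)) ⟨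
  suc m * continuationCount n m ∎
  where
  term : ℕ → ℕ
  term j = j ! * (suc m C j) * binomShift (suc n) j

SameRel-≡⇒ : ∀ {x y u v} → SameRel x y u v → x ≡ y → u ≡ v
SameRel-≡⇒ (_ , _ , p , _) = p

SameRel-≡⇐ : ∀ {x y u v} → SameRel x y u v → u ≡ v → x ≡ y
SameRel-≡⇐ (_ , _ , _ , p , _) = p

SameRel-< : ∀ {x y u v} → x ℕ.< y → u ℕ.< v → SameRel x y u v
SameRel-< x<y u<v =
  (λ _ → u<v) , (λ _ → x<y) , (λ x≡y → ⊥-elim (ℕ.<⇒≢ x<y x≡y)) , (λ u≡v → ⊥-elim (ℕ.<⇒≢ u<v u≡v))
  , (λ y<x → ⊥-elim (ℕ.<-asym x<y y<x)) , (λ v<u → ⊥-elim (ℕ.<-asym u<v v<u))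

SameRel-refl : ∀ {x u} → SameRel x x u u
SameRel-refl = (λ x<x → ⊥-elim (ℕ.<-irrefl refl x<x)) , (λ u<u → ⊥-elim (ℕ.<-irrefl refl u<u))
             , (λ _ → refl) , (λ _ → refl)
             , (λ x<x → ⊥-elim (ℕ.<-irrefl refl x<x)) , (λ u<u → ⊥-elim (ℕ.<-irrefl refl u<u))

SameRel-sym : ∀ {x y u v} → SameRel x y u v → SameRel y x v u
SameRel-sym (<⇒ , <⇐ , ≡⇒ , ≡⇐ , >⇒ , >⇐) = >⇒ , >⇐ , sym ∘ ≡⇒ ∘ sym , sym ∘ ≡⇐ ∘ sym , <⇒ , <⇐

SameRel-strictMono : (h : Fin ℓ → ℕ) → (∀ {p q} → p < q → h p ℕ.< h q) →
                     ∀ p q → SameRel (h p) (h q) (toℕ p) (toℕ q)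
SameRel-strictMono h mono p q with <-cmp p q
... | tri< p<q _ _ = SameRel-< (mono p<q) p<q
... | tri≈ _ refl _ = SameRel-refl
... | tri> _ _ q<p = SameRel-sym (SameRel-< (mono q<p) q<p)

contains-via : {σ : Word k n} {τ : Word ℓ m} (ι : Fin m → Fin n) → (∀ {a b} → a < b → ι a < ι b) →
               (h : Fin ℓ → ℕ) → (∀ {p q} → p < q → h p ℕ.< h q) →
               (∀ a → toℕ (lookup σ (ι a)) ≡ h (lookup τ a)) → Contains σ τ
contains-via {σ = σ} {τ} ι ι-mono h h-mono σ≡hτ = ι , (λ _ _ → ι-mono) , sameRel
  where
  sameRel : ∀ a b → SameRel (toℕ (lookup σ (ι a))) (toℕ (lookup σ (ι b)))
                            (toℕ (lookup τ a)) (toℕ (lookup τ b))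
  sameRel a b rewrite σ≡hτ a | σ≡hτ b = SameRel-strictMono h h-mono (lookup τ a) (lookup τ b)

triple : {A : Set} → A → A → A → Fin 3 → A
triple x y z zero = x
triple x y z (suc zero) = y
triple x y z (suc (suc zero)) = z

triple-strictMono : ∀ {i j l : Fin n} → i < j → j < l → ∀ {a b} → a < b → triple i j l a < triple i j l b
triple-strictMono i<j j<l {zero} {suc zero} _ = i<j
triple-strictMono i<j j<l {zero} {suc (suc zero)} _ = <-trans i<j j<l
triple-strictMono i<j j<l {suc zero} {suc (suc zero)} _ = j<l
triple-strictMono i<j j<l {zero} {zero} ()
triple-strictMono i<j j<l {suc zero} {zero} ()
triple-strictMono i<j j<l {suc zero} {suc zero} (s≤s ())
triple-strictMono i<j j<l {suc (suc zero)} {zero} ()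
triple-strictMono i<j j<l {suc (suc zero)} {suc zero} (s≤s ())
triple-strictMono i<j j<l {suc (suc zero)} {suc (suc zero)} (s≤s (s≤s ()))

pair : ℕ → ℕ → Fin 2 → ℕ
pair x y zero = x
pair x y (suc zero) = y

pair-strictMono : ∀ {x y} → x ℕ.< y → ∀ {p q} → p < q → pair x y p ℕ.< pair x y q
pair-strictMono x<y {zero} {suc zero} _ = x<y
pair-strictMono x<y {zero} {zero} ()
pair-strictMono x<y {suc zero} {zero} ()
pair-strictMono x<y {suc zero} {suc zero} (s≤s ())

record Sandwich (σ : Word k n) : Set where
  constructor sandwich
  field
    {i j l} : Fin n
    i<j     : i < j
    j<l     : j < l
    outer   : lookup σ i ≡ lookup σ l
    inner   : lookup σ i ≢ lookup σ j

contains-aba⇒sandwich : {σ : Word k n} {τ : Word ℓ 3} →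
  lookup τ zero ≡ lookup τ (suc (suc zero)) → lookup τ zero ≢ lookup τ (suc zero) →
  Contains σ τ → Sandwich σ
contains-aba⇒sandwich τ₀≡τ₂ τ₀≢τ₁ (ι , mono , sameRel) = sandwich
  (mono zero (suc zero) ℕ.z<s)
  (mono (suc zero) (suc (suc zero)) (s≤s ℕ.z<s))
  (toℕ-injective (SameRel-≡⇐ (sameRel zero (suc (suc zero))) (cong toℕ τ₀≡τ₂)))
  (τ₀≢τ₁ ∘ toℕ-injective ∘ SameRel-≡⇒ (sameRel zero (suc zero)) ∘ cong toℕ)

sandwich⇒contains : {σ : Word k n} → Sandwich σ → Contains σ p121 ⊎ Contains σ p212
sandwich⇒contains {σ = σ} (sandwich {i} {j} {l} i<j j<l outer inner)
  with <-cmp (lookup σ i) (lookup σ j)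
... | tri< σi<σj _ _ = inj₁ (contains-via {σ = σ} {τ = p121} (triple i j l) (triple-strictMono i<j j<l)
  (pair (toℕ (lookup σ i)) (toℕ (lookup σ j))) (pair-strictMono σi<σj)
  λ { zero → refl ; (suc zero) → refl ; (suc (suc zero)) → cong toℕ (sym outer) })
... | tri≈ _ σi≡σj _ = ⊥-elim (inner σi≡σj)
... | tri> _ _ σj<σi = inj₂ (contains-via {σ = σ} {τ = p212} (triple i j l) (triple-strictMono i<j j<l)
  (pair (toℕ (lookup σ j)) (toℕ (lookup σ i))) (pair-strictMono σj<σi)
  λ { zero → refl ; (suc zero) → refl ; (suc (suc zero)) → cong toℕ (sym outer) })

data Contiguous {k} : ∀ {n} → Word k n → Set where
  []     : Contiguous []
  fresh  : ∀ {n a} {σ : Word k n} → All (_≢ a) σ → Contiguous σ → Contiguous (a ∷ σ)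
  repeat : ∀ {n a} {σ : Word k n} → Contiguous (a ∷ σ) → Contiguous (a ∷ a ∷ σ)

contiguous-between : {σ : Word k n} → Contiguous σ → ∀ {i j l} → i < j → j < l →
                     lookup σ i ≡ lookup σ l → lookup σ i ≡ lookup σ j
contiguous-between (fresh a∉σ _) {zero} {_} {suc l} _ _ a≡σl = ⊥-elim (lookup⁺ a∉σ l (sym a≡σl))
contiguous-between (fresh _ c) {suc i} {suc j} {suc l} (s≤s i<j) (s≤s j<l) = contiguous-between c i<j j<l
contiguous-between (repeat _) {zero} {suc zero} _ _ _ = refl
contiguous-between (repeat c) {zero} {suc (suc j)} {suc l} _ (s≤s j<l) =
  contiguous-between c {zero} {suc j} ℕ.z<s j<l
contiguous-between (repeat c) {suc i} {suc j} {suc l} (s≤s i<j) (s≤s j<l) = contiguous-between c i<j j<l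

contiguous⇒¬sandwich : {σ : Word k n} → Contiguous σ → ¬ Sandwich σ
contiguous⇒¬sandwich c (sandwich i<j j<l outer inner) = inner (contiguous-between c i<j j<l outer)

sandwich-∷ : {a : Fin k} {σ : Word k n} → Sandwich σ → Sandwich (a ∷ σ)
sandwich-∷ (sandwich i<j j<l outer inner) = sandwich (s≤s i<j) (s≤s j<l) outer inner

¬sandwich⇒contiguous : (σ : Word k n) → ¬ Sandwich σ → Contiguous σ
¬sandwich⇒contiguous [] _ = []
¬sandwich⇒contiguous (a ∷ []) _ = fresh [] []
¬sandwich⇒contiguous (a ∷ b ∷ σ) ¬s = extend (b ≟ a) (¬sandwich⇒contiguous (b ∷ σ) (¬s ∘ sandwich-∷))
  where
  extend : Dec (b ≡ a) → Contiguous (b ∷ σ) → Contiguous (a ∷ b ∷ σ)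
  extend (yes refl) c = repeat c
  extend (no b≢a) c = fresh (b≢a ∷ lookup⁻ (λ p σp≡a → ¬s (sandwich {i = zero} {suc zero} {suc (suc p)}
                                           ℕ.z<s (s≤s ℕ.z<s) (sym σp≡a) (b≢a ∘ sym)))) c

contiguous⇔avoids : {σ : Word k n} → Contiguous σ ⇔ (Avoids σ p121 × Avoids σ p212)
contiguous⇔avoids {σ = σ} = mk⇔
  (λ c → contiguous⇒¬sandwich c ∘ contains-aba⇒sandwich {τ = p121} refl (λ ())
       , contiguous⇒¬sandwich c ∘ contains-aba⇒sandwich {τ = p212} refl (λ ()))
  (λ (avoids121 , avoids212) → ¬sandwich⇒contiguous σ ([ avoids121 , avoids212 ]′ ∘ sandwich⇒contains))

module _ {A : Set} where

  prependEach : List A → (A → List (Vec A n)) → List (Vec A (suc n))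
  prependEach [] L = []
  prependEach (y ∷ ys) L = map (y ∷_) (L y) ++ prependEach ys L

  ∈-map-∷⁻ : ∀ {x y : A} {σ : Vec A n} {ws} → y ∷ σ ∈ map (x ∷_) ws → y ≡ x × σ ∈ ws
  ∈-map-∷⁻ p with ∈-map⁻ _ p
  ... | _ , σ∈ws , refl = refl , σ∈ws

  ∈-prependEach⁺ : ∀ {y : A} {σ : Vec A n} {ys L} → y ∈ ys → σ ∈ L y → y ∷ σ ∈ prependEach ys L
  ∈-prependEach⁺ {ys = y ∷ _} (here refl) σ∈ = ∈-++⁺ˡ (∈-map⁺ (y ∷_) σ∈)
  ∈-prependEach⁺ {ys = y ∷ _} {L} (there y∈) σ∈ = ∈-++⁺ʳ (map (y ∷_) (L y)) (∈-prependEach⁺ y∈ σ∈)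

  ∈-prependEach⁻ : ∀ {y : A} {σ : Vec A n} ys {L} → y ∷ σ ∈ prependEach ys L → y ∈ ys × σ ∈ L y
  ∈-prependEach⁻ (y ∷ ys) {L} p with ∈-++⁻ (map (y ∷_) (L y)) p
  ... | inj₁ q with ∈-map-∷⁻ q
  ...   | refl , σ∈ = here refl , σ∈
  ∈-prependEach⁻ (y ∷ ys) p | inj₂ q with ∈-prependEach⁻ ys q
  ...   | y∈ , σ∈ = there y∈ , σ∈

  unique-++-prependEach : ∀ {x : A} {ys} {ws : List (Vec A n)} {L} → x ∉ ys → Unique ws →
    Unique (prependEach ys L) → Unique (map (x ∷_) ws ++ prependEach ys L)
  unique-++-prependEach {x = x} {ys = ys} {ws = ws} {L = L} x∉ys ws! rest! =
    ++⁺ (map⁺ ∷-injectiveʳ ws!) rest! disjoint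
    where
    disjoint : ∀ {v} → ¬ (v ∈ map (x ∷_) ws × v ∈ prependEach ys L)
    disjoint (p , q) with ∈-map⁻ (x ∷_) p
    ... | _ , _ , refl = x∉ys (proj₁ (∈-prependEach⁻ ys q))

  unique-prependEach : ∀ {ys} {L : A → List (Vec A n)} → Unique ys → (∀ y → Unique (L y)) →
    Unique (prependEach ys L)
  unique-prependEach [] _ = []
  unique-prependEach ys!@(_ ∷ tail!) L! =
    unique-++-prependEach (Unique[x∷xs]⇒x∉xs ys!) (L! _) (unique-prependEach tail! L!)

  length-prependEach : ∀ ys {L : A → List (Vec A n)} c → (∀ {y} → y ∈ ys → length (L y) ≡ c) →
    length (prependEach ys L) ≡ length ys * c
  length-prependEach [] c _ = refl
  length-prependEach (y ∷ ys) {L} c len = begin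
    length (map (y ∷_) (L y) ++ prependEach ys L)
      ≡⟨ length-++ (map (y ∷_) (L y)) ⟩
    length (map (y ∷_) (L y)) + length (prependEach ys L)
      ≡⟨ cong₂ _+_ (trans (length-map (y ∷_) (L y)) (len (here refl)))
                   (length-prependEach ys c (len ∘ there)) ⟩
    c + length ys * c ∎

module Remove {A : Set} (_≟_ : DecidableEquality A) where

  _≢?_ : ∀ z y → Dec (z ≢ y)
  z ≢? y = ¬? (z ≟ y)

  remove : A → List A → List A
  remove y = filter (_≢? y)

  ∉-remove : ∀ y us → y ∉ remove y us
  ∉-remove y us y∈ = proj₂ (∈-filter⁻ (_≢? y) {xs = us} y∈) refl

  ∈-∷-remove⁺ : ∀ {y z us} → z ∈ us → z ∈ y ∷ remove y us
  ∈-∷-remove⁺ {y} {z} z∈us with z ≟ y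
  ... | yes refl = here refl
  ... | no z≢y = there (∈-filter⁺ (_≢? y) z∈us z≢y)

  ∈-∷-remove⁻ : ∀ {y z us} → y ∈ us → z ∈ y ∷ remove y us → z ∈ us
  ∈-∷-remove⁻ y∈us (here refl) = y∈us
  ∈-∷-remove⁻ {y} {us = us} _ (there z∈) = proj₁ (∈-filter⁻ (_≢? y) {xs = us} z∈)

  unique-remove : ∀ y {us} → Unique us → Unique (remove y us)
  unique-remove y = filter⁺ (_≢? y)

  length-remove : ∀ {y us} → Unique us → y ∈ us → suc (length (remove y us)) ≡ length us
  length-remove {y} {_ ∷ us} (y∉us ∷ _) (here refl)
    rewrite filter-reject (_≢? y) {y} {us} (λ y≢y → y≢y refl)
          | filter-all (_≢? y) (ListAll.map (λ y≢z z≡y → y≢z (sym z≡y)) y∉us) = refl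
  length-remove {y} {z ∷ us} (z∉us ∷ us!) (there y∈us)
    rewrite filter-accept (_≢? y) {z} {us} (λ z≡y → ListAll.lookup z∉us y∈us z≡y) =
    cong suc (length-remove us! y∈us)

open module RemoveFin {k} = Remove (_≟_ {k})

continuations : ∀ n → Fin k → List (Fin k) → List (Word k n)
continuations zero x us = [ [] ]
continuations (suc n) x us =
  map (x ∷_) (continuations n x us) ++ prependEach us (λ y → continuations n y (remove y us))

continuations-sound : ∀ n {x : Fin k} {us σ} → x ∉ us → σ ∈ continuations n x us →
                      Contiguous (x ∷ σ) × All (_∈ x ∷ us) σ
continuations-sound zero {σ = []} _ _ = fresh [] [] , []
continuations-sound (suc n) {x} {us} {y ∷ σ} x∉us p with ∈-++⁻ (map (x ∷_) (continuations n x us)) p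
... | inj₁ q with ∈-map-∷⁻ q
...   | refl , σ∈ with continuations-sound n x∉us σ∈
...     | c , σ⊆ = repeat c , here refl ∷ σ⊆
continuations-sound (suc n) {x} {us} {y ∷ σ} x∉us p | inj₂ q with ∈-prependEach⁻ us q
...   | y∈us , σ∈ with continuations-sound n (∉-remove y us) σ∈
...     | c , σ⊆ = fresh (Allᵥ.map (λ z∈us z≡x → x∉us (subst (_∈ us) z≡x z∈us)) yσ⊆us) c
                 , Allᵥ.map there yσ⊆us
  where
  yσ⊆us : All (_∈ us) (y ∷ σ)
  yσ⊆us = y∈us ∷ Allᵥ.map (∈-∷-remove⁻ y∈us) σ⊆

continuations-complete : ∀ n {x : Fin k} {us σ} → Contiguous (x ∷ σ) → All (_∈ x ∷ us) σ →
                         σ ∈ continuations n x us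
continuations-complete zero {σ = []} _ _ = here refl
continuations-complete (suc n) (repeat c) (_ ∷ σ⊆) = ∈-++⁺ˡ (∈-map⁺ _ (continuations-complete n c σ⊆))
continuations-complete (suc n) {x} {us} {y ∷ σ} (fresh (y≢x ∷ x∉σ) c) (y∈ ∷ σ⊆) =
  ∈-++⁺ʳ (map (x ∷_) (continuations n x us))
    (∈-prependEach⁺ (fresh∈us y∈ y≢x)
      (continuations-complete n c
        (Allᵥ.map (λ (z∈ , z≢x) → ∈-∷-remove⁺ (fresh∈us z∈ z≢x)) (Allᵥ.zip (σ⊆ , x∉σ)))))
  where
  fresh∈us : ∀ {z} → z ∈ x ∷ us → z ≢ x → z ∈ us
  fresh∈us (here z≡x) z≢x = ⊥-elim (z≢x z≡x)
  fresh∈us (there z∈us) _ = z∈us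

continuations-unique : ∀ n {x : Fin k} {us} → x ∉ us → Unique us → Unique (continuations n x us)
continuations-unique zero _ _ = ListAll.[] ∷ []
continuations-unique (suc n) {us = us} x∉us us! =
  unique-++-prependEach x∉us (continuations-unique n x∉us us!)
    (unique-prependEach us! (λ y → continuations-unique n (∉-remove y us) (unique-remove y us!)))

length-continuations-remove : ∀ n {y : Fin k} {us} → Unique us → y ∈ us →
  length (continuations n y (remove y us)) ≡ continuationCount n (pred (length us))

length-continuations : ∀ n {x : Fin k} {us} → Unique us →
                       length (continuations n x us) ≡ continuationCount n (length us)
length-continuations zero {us = us} _ = sym (continuationCount-zero (length us))
length-continuations (suc n) {x} {us} us! = begin
  length (map (x ∷_) (continuations n x us) ++ prependEach us (λ y → continuations n y (remove y us)))
    ≡⟨ length-++ (map (x ∷_) (continuations n x us)) ⟩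
  length (map (x ∷_) (continuations n x us)) + length (prependEach us (λ y → continuations n y (remove y us)))
    ≡⟨ cong₂ _+_ (trans (length-map (x ∷_) (continuations n x us)) (length-continuations n us!))
                 (length-prependEach us _ (length-continuations-remove n us!)) ⟩
  continuationCount n (length us) + length us * continuationCount n (pred (length us))
    ≡⟨ continuationCount-suc n (length us) ⟨
  continuationCount (suc n) (length us) ∎

length-continuations-remove n us! y∈us =
  trans (length-continuations n (unique-remove _ us!))
        (cong (continuationCount n ∘ pred) (length-remove us! y∈us))

contiguousWords : ∀ n k → List (Word k n)
contiguousWords zero k = [ [] ]
contiguousWords (suc n) k = prependEach (allFin k) (λ x → continuations n x (remove x (allFin k)))

∈-contiguousWords : ∀ n {k} (σ : Word k n) → σ ∈ contiguousWords n k ⇔ Contiguous σ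
∈-contiguousWords zero [] = mk⇔ (λ _ → []) (λ _ → here refl)
∈-contiguousWords (suc n) {k} (x ∷ σ) = mk⇔
  (λ xσ∈ → proj₁ (continuations-sound n (∉-remove x (allFin k))
                                    (proj₂ (∈-prependEach⁻ (allFin k) xσ∈))))
  (λ c → ∈-prependEach⁺ (∈-allFin x)
            (continuations-complete n c (Allᵥ.universal (∈-∷-remove⁺ ∘ ∈-allFin) σ)))

contiguousWords-unique : ∀ n k → Unique (contiguousWords n k)
contiguousWords-unique zero k = ListAll.[] ∷ []
contiguousWords-unique (suc n) k = unique-prependEach (allFin⁺ k)
  (λ x → continuations-unique n (∉-remove x (allFin k)) (unique-remove x (allFin⁺ k)))

length-contiguousWords : ∀ n k → length (contiguousWords (suc n) k) ≡ k * continuationCount n (pred k)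
length-contiguousWords n k = begin
  length (contiguousWords (suc n) k)
    ≡⟨ length-prependEach (allFin k) _ (length-continuations-remove n (allFin⁺ k)) ⟩
  length (allFin k) * continuationCount n (pred (length (allFin k)))
    ≡⟨ cong (λ l → l * continuationCount n (pred l)) (length-tabulate {n = k} (λ i → i)) ⟩
  k * continuationCount n (pred k) ∎

contiguousWords-enumerate : ∀ n k → F121-212≡ n k (length (contiguousWords n k))
contiguousWords-enumerate n k =
  contiguousWords n k , contiguousWords-unique n k ,
  (λ σ → contiguous⇔avoids ⇔-∘ ∈-contiguousWords n σ) , refl

theorem10 : ((k n : ℕ) → n ≥ 1 → F121-212≡ n k (rhs n k))
            × ((k : ℕ) → F121-212≡ 0 k 1)
theorem10 = nonempty , (λ k → contiguousWords-enumerate 0 k)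
  where
  nonempty : (k n : ℕ) → n ≥ 1 → F121-212≡ n k (rhs n k)
  nonempty k (suc n) _ =
    subst (F121-212≡ (suc n) k) (trans (length-contiguousWords n k) (sym (rhs-suc n k)))
      (contiguousWords-enumerate (suc n) k)
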